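{- Let $\mathcal{L}=(\mathcal{S},\mathcal{A},(\xrightarrow{a})_{a\in\mathcal{A}})$ be a finite-branching LTS with a finite set of actions $\mathcal{A}$, and let $s_0\in\mathcal{S}$ be non-regular. Then there is an infinite path $s_0\xrightarrow{a_1}s_1\xrightarrow{a_2}s_2\xrightarrow{a_3}\cdots$ in $\mathcal{L}$ such that $s_i\not\sim s_j$ for all $i\neq j$.
   Context: An LTS $\mathcal{L}=(\mathcal{S},\mathcal{A},(\xrightarrow{a})_{a\in\mathcal{A}})$ is finite-branching if for every $s\in\mathcal{S}$ the set $\{s'\mid s\xrightarrow{a}s'\text{ for some }a\in\mathcal{A}\}$ is finite. $\sim$ denotes bisimilarity (the union of all bisimulations, where $\mathcal{B}\subseteq\mathcal{S}\times\mathcal{S}$ is a bisimulation if for each $(s,t)\in\mathcal{B}$ every $s\xrightarrow{a}s'$ has some $t\xrightarrow{a}t'$ with $(s',t')\in\mathcal{B}$ and vice versa). For $s\in\mathcal{S}$, $[s]=\{s'\mid s'\sim s\}$. $s'$ is reachable from $s$ if $s\xrightarrow{a_1}\cdots\xrightarrow{a_n}s'$ for some $n\ge 0$ and actions $a_i$. A state $s_0$ is regular if the set $\{[s]\mid s\text{ reachable from }s_0\}$ is finite, and non-regular otherwise. -}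

module Defs where

open import Data.Nat using (ℕ; suc)
open import Data.Product using (Σ; ∃; ∃-syntax; _×_; _,_)
open import Data.List using (List)
open import Data.List.Membership.Propositional using (_∈_)
open import Relation.Binary.PropositionalEquality using (_≡_; _≢_)
open import Relation.Nullary using (¬_)

record LTS : Set₁ where
  field
    State : Set
    Act   : Set
    _⟶[_]_ : State → Act → State → Set

module _ (L : LTS) where
  open LTS L

  FiniteActions : Set
  FiniteActions = Σ (List Act) λ as → ∀ a → a ∈ as

  FiniteBranching : Set
  FiniteBranching = ∀ s → Σ (List State) λ ss → ∀ a s' → s ⟶[ a ] s' → s' ∈ ss

  IsBisimulation : (State → State → Set) → Set
  IsBisimulation B = ∀ s t → B s t →
      (∀ a s' → s ⟶[ a ] s' → ∃[ t' ] (t ⟶[ a ] t' × B s' t'))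
    × (∀ a t' → t ⟶[ a ] t' → ∃[ s' ] (s ⟶[ a ] s' × B s' t'))

  _∼_ : State → State → Set₁
  s ∼ t = Σ (State → State → Set) λ B → IsBisimulation B × B s t

  data Reachable (s : State) : State → Set where
    here : Reachable s s
    step : ∀ {s' s'' a} → Reachable s s' → s' ⟶[ a ] s'' → Reachable s s''

  -- s0 is regular: the set {[s] | s reachable from s0} is finite, i.e. there is
  -- a finite list of representatives covering every such class.
  Regular : State → Set₁
  Regular s₀ = Σ (List State) λ rs →
    ∀ s → Reachable s₀ s → ∃[ r ] (r ∈ rs × s ∼ r)

  NonRegular : State → Set₁
  NonRegular s₀ = ¬ Regular s₀

  InfiniteDistinctPath : State → Set₁
  InfiniteDistinctPath s₀ =
    Σ (ℕ → State) λ s → Σ (ℕ → Act) λ a →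
        (s 0 ≡ s₀)
      × (∀ i → s i ⟶[ a (suc i) ] s (suc i))
      × (∀ i j → i ≢ j → ¬ (s i ∼ s j))

-- Call s regular relative to a finite list h of states if the states reachable from s along
-- paths that avoid the classes of h fall into finitely many classes.  If s is non-regular
-- relative to h, then some successor s' is non-regular relative to s ∷ h: a path from s that
-- avoids h either ends in [s], or, cut at its last visit to [s] and transported along the
-- bisimulation, becomes a path from a successor of s that avoids s ∷ h.  With finitely many
-- successors, regularity of all of them would make s regular.  Starting from h = [] and
-- iterating gives a path whose every state is non-bisimilar to all earlier ones.
module Submission where

open import Level using (suc; zero)
open import Axiom.ExcludedMiddle using (ExcludedMiddle)
open import Axiom.DoubleNegationElimination using (em⇒dne)
open import Defs
open import Data.Nat using (ℕ; pred; _<_; s≤s)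
open import Data.Nat.Properties using (m≤n⇒m<n∨m≡n; <-cmp)
open import Data.Product using (Σ; ∃-syntax; _×_; _,_; proj₁; proj₂)
open import Data.Sum using (_⊎_; inj₁; inj₂)
open import Data.List using (List; []; _∷_; _++_)
open import Data.List.Membership.Propositional using (_∈_)
open import Data.List.Membership.Propositional.Properties using (∈-++⁺ˡ; ∈-++⁺ʳ)
open import Data.List.Relation.Unary.All as All using (All; []; _∷_)
open import Data.List.Relation.Unary.Any using (here; there)
open import Data.Empty using (⊥-elim)
open import Function using (flip; _∘_)
open import Relation.Binary.Definitions using (tri<; tri≈; tri>)
open import Relation.Binary.PropositionalEquality using (_≡_; _≢_; refl)
open import Relation.Nullary using (¬_; yes; no)

module _ (L : LTS) where
  open LTS L

  infix 4 _≈_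
  _≈_ : State → State → Set₁
  _≈_ = _∼_ L

  isBisimulation-≡ : IsBisimulation L _≡_
  isBisimulation-≡ s .s refl = (λ a s' tr → s' , tr , refl) , (λ a t' tr → t' , tr , refl)

  isBisimulation-flip : ∀ {B} → IsBisimulation L B → IsBisimulation L (flip B)
  isBisimulation-flip isB s t b = proj₂ (isB t s b) , proj₁ (isB t s b)

  isBisimulation-composition : ∀ {B C} → IsBisimulation L B → IsBisimulation L C →
    IsBisimulation L (λ x z → ∃[ y ] (B x y × C y z))
  isBisimulation-composition {B} {C} isB isC x z (y , bxy , cyz) = forth , back
    where
      forth : ∀ a x' → x ⟶[ a ] x' → ∃[ z' ] (z ⟶[ a ] z' × ∃[ y' ] (B x' y' × C y' z'))
      forth a x' tr with proj₁ (isB x y bxy) a x' tr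
      ... | y' , tr′ , b′ with proj₁ (isC y z cyz) a y' tr′
      ...   | z' , tr″ , c′ = z' , tr″ , y' , b′ , c′
      back : ∀ a z' → z ⟶[ a ] z' → ∃[ x' ] (x ⟶[ a ] x' × ∃[ y' ] (B x' y' × C y' z'))
      back a z' tr with proj₂ (isC y z cyz) a z' tr
      ... | y' , tr′ , c′ with proj₂ (isB x y bxy) a y' tr′
      ...   | x' , tr″ , b′ = x' , tr″ , y' , b′ , c′

  ≈-refl : ∀ {s} → s ≈ s
  ≈-refl = _≡_ , isBisimulation-≡ , refl

  ≈-sym : ∀ {s t} → s ≈ t → t ≈ s
  ≈-sym (B , isB , b) = flip B , isBisimulation-flip isB , b

  ≈-trans : ∀ {s t u} → s ≈ t → t ≈ u → s ≈ u
  ≈-trans (B , isB , b) (C , isC , c) = _ , isBisimulation-composition isB isC , _ , b , c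

  ≈-simulate : ∀ {s t a s'} → s ≈ t → s ⟶[ a ] s' → ∃[ t' ] (t ⟶[ a ] t' × s' ≈ t')
  ≈-simulate (B , isB , b) tr with proj₁ (isB _ _ b) _ _ tr
  ... | t' , tr′ , b′ = t' , tr′ , B , isB , b′

  Avoids : List State → State → Set₁
  Avoids h u = All (λ x → ¬ u ≈ x) h

  avoids-≈ : ∀ {h x y} → x ≈ y → Avoids h x → Avoids h y
  avoids-≈ x≈y = All.map (λ x≉z y≈z → x≉z (≈-trans x≈y y≈z))

  data AvoidingPath (h : List State) : State → State → Set₁ where
    [_]  : ∀ {s} → Avoids h s → AvoidingPath h s s
    _∷⟨_⟩_ : ∀ {s s' t a} → Avoids h s → s ⟶[ a ] s' → AvoidingPath h s' t → AvoidingPath h s t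

  source-avoids : ∀ {h s t} → AvoidingPath h s t → Avoids h s
  source-avoids [ av ] = av
  source-avoids (av ∷⟨ _ ⟩ _) = av

  snoc : ∀ {h s t t' a} → AvoidingPath h s t → t ⟶[ a ] t' → Avoids h t' → AvoidingPath h s t'
  snoc [ av ] tr av′ = av ∷⟨ tr ⟩ [ av′ ]
  snoc (av ∷⟨ tr ⟩ p) tr′ av′ = av ∷⟨ tr ⟩ snoc p tr′ av′

  reachable⇒avoidingPath[] : ∀ {s t} → Reachable L s t → AvoidingPath [] s t
  reachable⇒avoidingPath[] here = [ [] ]
  reachable⇒avoidingPath[] (step r tr) = snoc (reachable⇒avoidingPath[] r) tr []

  transport : ∀ {h x y t} → x ≈ y → AvoidingPath h x t → ∃[ t' ] (AvoidingPath h y t' × t ≈ t')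
  transport x≈y [ av ] = _ , [ avoids-≈ x≈y av ] , x≈y
  transport x≈y (av ∷⟨ tr ⟩ p) with ≈-simulate x≈y tr
  ... | y' , tr′ , x'≈y' with transport x'≈y' p
  ...   | t' , q , t≈t' = t' , avoids-≈ x≈y av ∷⟨ tr′ ⟩ q , t≈t'

  Covers : List State → List State → State → Set₁
  Covers h rs s = ∀ t → AvoidingPath h s t → ∃[ r ] (r ∈ rs × t ≈ r)

  RegularAvoiding : List State → State → Set₁
  RegularAvoiding h s = Σ (List State) λ rs → Covers h rs s

  NonRegularAvoiding : List State → State → Set₁
  NonRegularAvoiding h s = ¬ RegularAvoiding h s

  regularAvoiding[]⇒regular : ∀ {s} → RegularAvoiding [] s → Regular L s
  regularAvoiding[]⇒regular (rs , cover) = rs , λ t r → cover t (reachable⇒avoidingPath[] r)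

  nonRegularAvoiding⇒avoids : ∀ {h s} → NonRegularAvoiding h s → Avoids h s
  nonRegularAvoiding⇒avoids nr = All.tabulate λ x∈h s≈x →
    nr ([] , λ t p → ⊥-elim (All.lookup (source-avoids p) x∈h s≈x))

  record Stage : Set₁ where
    constructor stage
    field
      history    : List State
      current    : State
      nonRegular : NonRegularAvoiding history current

  module _ (em : ExcludedMiddle (suc zero)) where

    ThroughSuccessor : List State → State → State → Set₁
    ThroughSuccessor h s t =
      Σ Act λ a → Σ State λ s' → s ⟶[ a ] s' × ∃[ t' ] (AvoidingPath (s ∷ h) s' t' × t ≈ t')

    -- Recursing on the tail first puts the cut at the last state bisimilar to s.
    split-at-last-visit : ∀ {h u t} s → AvoidingPath h u t →
      AvoidingPath (s ∷ h) u t ⊎ t ≈ s ⊎ ThroughSuccessor h s t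
    split-at-last-visit s [ av ] with em {_ ≈ s}
    ... | yes t≈s = inj₂ (inj₁ t≈s)
    ... | no t≉s = inj₁ [ t≉s ∷ av ]
    split-at-last-visit s (av ∷⟨ tr ⟩ p) with split-at-last-visit s p
    ... | inj₂ done = inj₂ done
    ... | inj₁ q with em {_ ≈ s}
    ...   | no u≉s = inj₁ ((u≉s ∷ av) ∷⟨ tr ⟩ q)
    ...   | yes u≈s with ≈-simulate u≈s tr
    ...     | s' , tr′ , u'≈s' with transport u'≈s' q
    ...       | t' , q′ , t≈t' = inj₂ (inj₂ (_ , s' , tr′ , t' , q′ , t≈t'))

    covers-regular-members : ∀ h xs → Σ (List State) λ rs →
      ∀ {x} → x ∈ xs → RegularAvoiding h x → Covers h rs x
    covers-regular-members h [] = [] , λ ()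
    covers-regular-members h (y ∷ xs) with covers-regular-members h xs | em {RegularAvoiding h y}
    ... | rs , cover | no ¬reg = rs , λ
      { (here refl) reg → ⊥-elim (¬reg reg)
      ; (there x∈xs) reg → cover x∈xs reg }
    ... | rs , cover | yes (ry , cover-y) = ry ++ rs , λ
      { (here refl) _ t p → let (r , r∈ry , t≈r) = cover-y t p in r , ∈-++⁺ˡ r∈ry , t≈r
      ; (there x∈xs) reg t p → let (r , r∈rs , t≈r) = cover x∈xs reg t p in r , ∈-++⁺ʳ ry r∈rs , t≈r }

    nonRegularAvoiding-successor : FiniteBranching L → ∀ {h s} → NonRegularAvoiding h s →
      Σ Act λ a → Σ State λ s' → s ⟶[ a ] s' × NonRegularAvoiding (s ∷ h) s'
    nonRegularAvoiding-successor fb {h} {s} nr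
      with em {Σ Act λ a → Σ State λ s' → s ⟶[ a ] s' × NonRegularAvoiding (s ∷ h) s'}
    ... | yes succ = succ
    ... | no no-succ with covers-regular-members (s ∷ h) (proj₁ (fb s))
    ...   | rs , cover-members = ⊥-elim (nr (s ∷ rs , cover))
      where
        cover : Covers h (s ∷ rs) s
        cover t p with split-at-last-visit s p
        ... | inj₁ q = ⊥-elim (All.head (source-avoids q) ≈-refl)
        ... | inj₂ (inj₁ t≈s) = s , here refl , t≈s
        ... | inj₂ (inj₂ (a , s' , tr , t' , q , t≈t')) =
          let reg = em⇒dne em (λ nr′ → no-succ (a , s' , tr , nr′))
              (r , r∈rs , t'≈r) = cover-members (proj₂ (fb s) a s' tr) reg t' q
          in r , there r∈rs , ≈-trans t≈t' t'≈r

    module DistinctPath (fb : FiniteBranching L) (s₀ : State) (nr₀ : NonRegularAvoiding [] s₀) where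
      open Stage

      stages : ℕ → Stage
      stages 0 = stage [] s₀ nr₀
      stages (ℕ.suc n) with stages n
      ... | stage h s nr with nonRegularAvoiding-successor fb nr
      ...   | _ , s' , _ , nr′ = stage (s ∷ h) s' nr′

      state : ℕ → State
      state = current ∘ stages

      -- The path's actions are a₁, a₂, …; the value at 0 is an arbitrary choice.
      action : ℕ → Act
      action n = proj₁ (nonRegularAvoiding-successor fb (nonRegular (stages (pred n))))

      state-step : ∀ i → state i ⟶[ action (ℕ.suc i) ] state (ℕ.suc i)
      state-step i = proj₁ (proj₂ (proj₂ (nonRegularAvoiding-successor fb (nonRegular (stages i)))))

      earlier-in-history : ∀ {i j} → i < j → state i ∈ history (stages j)
      earlier-in-history {i} {ℕ.suc j} (s≤s i≤j) with m≤n⇒m<n∨m≡n i≤j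
      ... | inj₁ i<j = there (earlier-in-history i<j)
      ... | inj₂ refl = here refl

      later-not-bisimilar : ∀ {i j} → i < j → ¬ state j ≈ state i
      later-not-bisimilar {j = j} i<j =
        All.lookup (nonRegularAvoiding⇒avoids (nonRegular (stages j))) (earlier-in-history i<j)

      states-not-bisimilar : ∀ i j → i ≢ j → ¬ state i ≈ state j
      states-not-bisimilar i j i≢j with <-cmp i j
      ... | tri< i<j _ _ = later-not-bisimilar i<j ∘ ≈-sym
      ... | tri≈ _ i≡j _ = ⊥-elim (i≢j i≡j)
      ... | tri> _ _ j<i = later-not-bisimilar j<i

proposition3 : ExcludedMiddle (suc zero) →
    (L : LTS) → FiniteActions L → FiniteBranching L →
    (s₀ : LTS.State L) → NonRegular L s₀ → InfiniteDistinctPath L s₀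
proposition3 em L _ fb s₀ nr = state , action , refl , state-step , states-not-bisimilar
  where open DistinctPath L em fb s₀ (nr ∘ regularAvoiding[]⇒regular L)
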